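{- Let $p$ be a prime with $p\equiv 3\pmod 4$. Then for every integer $d$ with $1\le d<p-1$ and $\gcd(d,p-1)=1$ and every $c\in\mathbb{F}_p$, the permutation of $\mathbb{F}_p$ induced by $x\mapsto x^d+c$ is an even permutation. -}

module Defs where

open import Data.Nat using (ℕ; _^_; _+_; _%_; NonZero)
open import Data.Nat.DivMod using (_mod_)
open import Data.Nat.Primality using (Prime; prime⇒nonZero)
open import Data.Fin using (Fin; toℕ; _<_; _<?_)
open import Data.List using (List; length; filter; allFin; cartesianProduct)
open import Data.Product using (_×_; _,_; proj₁; proj₂)
open import Relation.Nullary using (Dec; yes; no)
open import Relation.Nullary.Decidable using (_×-dec_)

-- Elements of F_p are represented by Fin p (residues 0,…,p-1).
-- The map x ↦ x^d + c on F_p.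
powMap : (p : ℕ) → .{{NonZero p}} → (d : ℕ) → Fin p → Fin p → Fin p
powMap p d c x = ((toℕ x ^ d) + toℕ c) mod p

powMapPrime : (p : ℕ) → Prime p → (d : ℕ) → Fin p → Fin p → Fin p
powMapPrime p pp d c x = powMap p {{prime⇒nonZero pp}} d c x

inversions : {n : ℕ} → (Fin n → Fin n) → List (Fin n × Fin n)
inversions {n} f =
  filter (λ ij → (proj₁ ij <? proj₂ ij) ×-dec (f (proj₂ ij) <? f (proj₁ ij)))
         (cartesianProduct (allFin n) (allFin n))

data Even : ℕ → Set where
  even0  : Even 0
  even+2 : ∀ {n} → Even n → Even (Data.Nat.suc (Data.Nat.suc n))

IsEvenPerm : {n : ℕ} → (Fin n → Fin n) → Set
IsEvenPerm f = Even (length (inversions f))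

{-# OPTIONS --safe #-}
module Submission where

-- Write p = 2m + 1 with m odd and compute parities of inversion counts in 𝔽₂. Since p is odd,
-- composing with the translation x ↦ x + c changes the number of inversions by an even amount,
-- so it suffices to treat g x = x ^ d. As d is odd, g commutes with negation; pairing an
-- inversion (i , j) with (- j , - i) shows that g has the parity of #{1 ≤ x ≤ m : g x > m}.
-- Let χ be the quadratic character and ψ x = χ x + [x > m] (mod 2). Since -1 is a non-square
-- (m odd), ψ (- x) = ψ x, and since d is odd, χ (g x) = χ x; hence [g x > m] = ψ (g x) + ψ x
-- for 1 ≤ x ≤ m. Both ψ and ψ ∘ g are invariant under negation and g permutes the non-zero
-- residues, so they have the same sum over 1 ≤ x ≤ m, and the count is even. Injectivity of g
-- follows from Fermat's little theorem and a Bézout relation between d and p - 1.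

open import Defs
open import Algebra.Bundles using (CommutativeRing)
import Algebra.Properties.CommutativeMonoid.Sum as CommutativeMonoidSum
import Algebra.Properties.Semiring.Sum as SemiringSum
open import Data.Bool using (Bool; true; false; not; _∧_; _xor_; if_then_else_)
open import Data.Bool.Properties
  using (xor-∧-commutativeRing; xor-same; xor-identityʳ; xor-annihilates-not; not-involutive;
         not-distribˡ-xor; not-distribʳ-xor; ∧-identityʳ; ∧-zeroʳ; ∧-distribˡ-xor; ∧-distribʳ-xor)
open import Data.Fin using (Fin; zero; suc; toℕ; opposite; _<?_; _≟_)
open import Data.Fin.Base using (punchOut)
open import Data.Fin.Permutation using (Permutation; permutation)
open import Data.Fin.Properties
  using (<-cmp; any?; injective⇒≤; punchOut-injective; opposite-prop; opposite-involutive;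
         toℕ<n; toℕ-injective; toℕ-fromℕ<)
  renaming (suc-injective to Fin-suc-injective)
open import Data.List using (_++_; length; filter; tabulate; cartesianProduct)
  renaming (map to List-map)
open import Data.List.Properties using (filter-++; length-++; map-tabulate)
open import Data.Nat
  using (ℕ; zero; suc; _+_; _*_; _^_; _∸_; _<_; _≤_; s≤s; s≤s⁻¹; NonZero; >-nonZero⁻¹;
         nonTrivial⇒≢1; nonTrivial⇒n>1)
import Data.Nat as ℕ
open import Data.Nat.DivMod
  using (_%_; _/_; _mod_; m≡m%n+[m/n]*n; m<n⇒m%n≡m; m≤n⇒[n∸m]%m≡n%m; m%n%n≡m%n; m%n<n;
         %-distribˡ-+; %-distribˡ-*; [m+kn]%n≡m%n; m*n%n≡0)
open import Data.Nat.Divisibility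
  using (_∣_; divides; ∣-refl; ∣m∣n⇒∣m+n; ∣1⇒≡1; ∣⇒≤; >⇒∤; m%n≡0⇒n∣m)
open import Data.Nat.GCD using (gcd; gcd-GCD; gcd-greatest; module Bézout)
open import Data.Nat.Primality using (Prime; euclidsLemma; prime⇒nonTrivial)
open import Data.Nat.Properties
  using (+-*-semiring; *-1-commutativeMonoid; +-comm; +-suc; +-cancelˡ-≡; *-comm; *-suc;
         *-identityˡ; *-identityʳ; *-cancelˡ-≡; *-distribˡ-∸; *-distribʳ-∸; ^-*-assoc; ^-zeroˡ;
         ^-distribˡ-+-*; suc-injective; n<1+n; <-irrefl; <-asym; <-trans; <-≤-trans; <⇒≤;
         ≤-antisym; ≤-total; ≰⇒>; m≤n+m; +-monoˡ-<; +-cancelʳ-<; +-∸-assoc; m∸n+n≡m; m+n∸n≡m;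
         [m+n]∸[m+o]≡n∸o; ∸-monoˡ-<; ∸-monoʳ-<; ∸-cancelʳ-<)
open import Data.Nat.Tactic.RingSolver using (solve-∀)
open import Data.Product using (_×_; _,_; proj₁; proj₂; ∃)
open import Data.Sum using (_⊎_; inj₁; inj₂; [_,_]′)
open import Function using (_∘_; id)
open import Function.Bundles using (mk⇔)
open import Function.Definitions using (Injective)
open import Relation.Binary.Bundles using (Setoid)
open import Relation.Binary.Definitions using (tri<; tri≈; tri>)
open import Relation.Binary.PropositionalEquality
  using (_≡_; _≢_; _≗_; refl; sym; trans; cong; cong₂; subst; subst₂; module ≡-Reasoning)
import Relation.Binary.Reasoning.Setoid as SetoidReasoning
open import Relation.Nullary using (¬_; does; yes; no)
open import Relation.Nullary.Decidable using (_×-dec_; dec-true; dec-false; does-⇔)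
open import Relation.Nullary.Negation using (contradiction)
open import Relation.Unary using (Pred; Decidable)

-- Parities and inversion counts

module 𝔽₂ = SemiringSum (CommutativeRing.semiring xor-∧-commutativeRing)
module ℕΣ = SemiringSum +-*-semiring
module ℕΠ = CommutativeMonoidSum *-1-commutativeMonoid
open 𝔽₂ using () renaming (sum to ⨁)
open ℕΣ using () renaming (sum to ∑)
open ℕΠ using () renaming (sum to ∏)

infixl 10 ⨁-syntax
⨁-syntax : ∀ n → (Fin n → Bool) → Bool
⨁-syntax n = ⨁ {n}
syntax ⨁-syntax n (λ i → x) = ⨁[ i < n ] x

parity : ℕ → Bool
parity zero    = false
parity (suc n) = not (parity n)

parity-+ : ∀ m n → parity (m + n) ≡ parity m xor parity n
parity-+ zero    n = refl
parity-+ (suc m) n = trans (cong not (parity-+ m n)) (not-distribˡ-xor (parity m) (parity n))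

parity-double : ∀ n → parity (n + n) ≡ false
parity-double n = trans (parity-+ n n) (xor-same (parity n))

parity≡false⇒Even : ∀ n → parity n ≡ false → Even n
parity≡false⇒Even zero          _  = even0
parity≡false⇒Even (suc zero)    ()
parity≡false⇒Even (suc (suc n)) eq = even+2 (parity≡false⇒Even n (trans (sym (not-involutive _)) eq))

parity≡false⇒2∣ : ∀ n → parity n ≡ false → 2 ∣ n
parity≡false⇒2∣ zero          _  = divides 0 refl
parity≡false⇒2∣ (suc zero)    ()
parity≡false⇒2∣ (suc (suc n)) eq =
  ∣m∣n⇒∣m+n (∣-refl {2}) (parity≡false⇒2∣ n (trans (sym (not-involutive _)) eq))

coprime-to-even⇒odd : ∀ {d} m → gcd d (m + m) ≡ 1 → parity d ≡ true
coprime-to-even⇒odd {d} m coprime with parity d in d-parity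
... | true  = refl
... | false = contradiction (∣1⇒≡1 (subst (2 ∣_) coprime 2∣gcd)) λ ()
  where
  m+m≡m*2 : ∀ m → m + m ≡ m * 2
  m+m≡m*2 = solve-∀
  2∣gcd : 2 ∣ gcd d (m + m)
  2∣gcd = gcd-greatest {d} {m + m} (parity≡false⇒2∣ d d-parity) (divides m (m+m≡m*2 m))

𝟙 : Bool → ℕ
𝟙 true  = 1
𝟙 false = 0

count : ∀ {n} → (Fin n → Bool) → ℕ
count P = ∑ (𝟙 ∘ P)

parity-count : ∀ {n} (P : Fin n → Bool) → parity (count P) ≡ ⨁[ i < n ] P i
parity-count {zero}  P = refl
parity-count {suc n} P with P zero
... | true  = cong not (parity-count (P ∘ suc))
... | false = parity-count (P ∘ suc)

⨁-true : ∀ n → ⨁[ i < n ] true ≡ parity n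
⨁-true zero    = refl
⨁-true (suc n) = cong not (⨁-true n)

module _ {a ℓ} {A : Set a} {P : Pred A ℓ} (P? : Decidable P) where

  parity-filter-++ : ∀ xs ys → parity (length (filter P? (xs ++ ys)))
                             ≡ parity (length (filter P? xs)) xor parity (length (filter P? ys))
  parity-filter-++ xs ys = begin
    parity (length (filter P? (xs ++ ys)))                  ≡⟨ cong (parity ∘ length) (filter-++ P? xs ys) ⟩
    parity (length (filter P? xs ++ filter P? ys))          ≡⟨ cong parity (length-++ (filter P? xs)) ⟩
    parity (length (filter P? xs) + length (filter P? ys))  ≡⟨ parity-+ (length (filter P? xs)) _ ⟩
    parity (length (filter P? xs)) xor parity (length (filter P? ys)) ∎
    where open ≡-Reasoning

  parity-filter-tabulate : ∀ {n} (f : Fin n → A) →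
                           parity (length (filter P? (tabulate f))) ≡ ⨁[ i < n ] does (P? (f i))
  parity-filter-tabulate {zero}  f = refl
  parity-filter-tabulate {suc n} f with does (P? (f zero))
  ... | true  = cong not (parity-filter-tabulate (f ∘ suc))
  ... | false = parity-filter-tabulate (f ∘ suc)

parity-filter-cartesianProduct :
  ∀ {a b ℓ} {A : Set a} {B : Set b} {P : Pred (A × B) ℓ} (P? : Decidable P) {m n}
  (f : Fin m → A) (g : Fin n → B) →
  parity (length (filter P? (cartesianProduct (tabulate f) (tabulate g))))
    ≡ ⨁[ i < m ] ⨁[ j < n ] does (P? (f i , g j))
parity-filter-cartesianProduct P? {zero}  f g = refl
parity-filter-cartesianProduct P? {suc m} f g = begin
  parity (length (filter P? (cartesianProduct (tabulate f) (tabulate g))))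
    ≡⟨ parity-filter-++ P? (List-map (f zero ,_) (tabulate g)) _ ⟩
  parity (length (filter P? (List-map (f zero ,_) (tabulate g))))
    xor parity (length (filter P? (cartesianProduct (tabulate (f ∘ suc)) (tabulate g))))
    ≡⟨ cong₂ _xor_ (trans (cong (parity ∘ length ∘ filter P?) (map-tabulate g (f zero ,_)))
                          (parity-filter-tabulate P? (λ j → f zero , g j)))
                   (parity-filter-cartesianProduct P? (f ∘ suc) g) ⟩
  ⨁[ i < suc m ] ⨁[ j < _ ] does (P? (f i , g j)) ∎
  where open ≡-Reasoning

inversionParity : ∀ {n} → (Fin n → Fin n) → Bool
inversionParity {n} h = ⨁[ i < n ] ⨁[ j < n ] (does (i <? j) ∧ does (h j <? h i))

inversionParity-cong : ∀ {n} {f g : Fin n → Fin n} → f ≗ g → inversionParity f ≡ inversionParity g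
inversionParity-cong {n} f≗g = 𝔽₂.sum-cong-≗ {n} (λ i → 𝔽₂.sum-cong-≗ {n} (λ j →
  cong₂ (λ x y → does (i <? j) ∧ does (x <? y)) (f≗g j) (f≗g i)))

parity-inversions : ∀ {n} (h : Fin n → Fin n) → parity (length (inversions h)) ≡ inversionParity h
parity-inversions h = parity-filter-cartesianProduct
  (λ ij → (proj₁ ij <? proj₂ ij) ×-dec (h (proj₂ ij) <? h (proj₁ ij))) id id

-- Double sums in 𝔽₂ and involutions

data OneOf₃ : Bool → Bool → Bool → Set where
  first  : OneOf₃ true  false false
  second : OneOf₃ false true  false
  third  : OneOf₃ false false true

<-oneOf₃ : ∀ {n} (i j : Fin n) → OneOf₃ (does (i <? j)) (does (i ≟ j)) (does (j <? i))
<-oneOf₃ i j with <-cmp i j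
... | tri< i<j i≢j j≮i
  rewrite dec-true (i <? j) i<j | dec-false (i ≟ j) i≢j | dec-false (j <? i) j≮i = first
... | tri≈ i≮j i≡j j≮i
  rewrite dec-false (i <? j) i≮j | dec-true (i ≟ j) i≡j | dec-false (j <? i) j≮i = second
... | tri> i≮j i≢j j<i
  rewrite dec-false (i <? j) i≮j | dec-false (i ≟ j) i≢j | dec-true (j <? i) j<i = third

xor-oneOf₃ : ∀ {a b c} → OneOf₃ a b c → ∀ x → x ≡ (a ∧ x) xor ((b ∧ x) xor (c ∧ x))
xor-oneOf₃ first  false = refl
xor-oneOf₃ first  true  = refl
xor-oneOf₃ second false = refl
xor-oneOf₃ second true  = refl
xor-oneOf₃ third  false = refl
xor-oneOf₃ third  true  = refl

𝟙-oneOf₃ : ∀ {a b c} → OneOf₃ a b c → ∀ x → 𝟙 x ≡ 𝟙 (a ∧ x) + (𝟙 (b ∧ x) + 𝟙 (c ∧ x))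
𝟙-oneOf₃ first  false = refl
𝟙-oneOf₃ first  true  = refl
𝟙-oneOf₃ second false = refl
𝟙-oneOf₃ second true  = refl
𝟙-oneOf₃ third  false = refl
𝟙-oneOf₃ third  true  = refl

xor-cancel : ∀ x y → x xor (y xor x) ≡ y
xor-cancel false y = xor-identityʳ y
xor-cancel true  y = trans (not-distribʳ-xor y true) (xor-identityʳ y)

⨁-δ : ∀ {n} (i : Fin n) (f : Fin n → Bool) → ⨁[ j < n ] (does (i ≟ j) ∧ f j) ≡ f i
⨁-δ {suc n} zero    f = trans (cong (f zero xor_) (𝔽₂.sum-replicate-zero n)) (xor-identityʳ (f zero))
⨁-δ         (suc i) f = ⨁-δ i (f ∘ suc)

⨁⨁-distrib-xor : ∀ {m n} (f g : Fin m → Fin n → Bool) →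
                 ⨁[ i < m ] ⨁[ j < n ] (f i j xor g i j)
                   ≡ (⨁[ i < m ] ⨁[ j < n ] f i j) xor (⨁[ i < m ] ⨁[ j < n ] g i j)
⨁⨁-distrib-xor {m} {n} f g =
  trans (𝔽₂.sum-cong-≗ {m} (λ i → 𝔽₂.∑-distrib-+ {n} (f i) (g i)))
        (𝔽₂.∑-distrib-+ {m} (λ i → ⨁[ j < n ] f i j) (λ i → ⨁[ j < n ] g i j))

⨁-≢ : ∀ {n} → parity n ≡ true → (i : Fin n) → ⨁[ j < n ] (does (i <? j) xor does (j <? i)) ≡ false
⨁-≢ {n} n-odd i = begin
  ⨁[ j < n ] (does (i <? j) xor does (j <? i))
    ≡⟨ 𝔽₂.sum-cong-≗ {n} (λ j → ≢-as-xor (<-oneOf₃ i j)) ⟩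
  ⨁[ j < n ] (true xor does (i ≟ j))
    ≡⟨ 𝔽₂.∑-distrib-+ {n} (λ _ → true) (λ j → does (i ≟ j)) ⟩
  (⨁[ j < n ] true) xor (⨁[ j < n ] does (i ≟ j))
    ≡⟨ cong₂ _xor_ (trans (⨁-true n) n-odd) ⨁-≡ ⟩
  false ∎
  where
  open ≡-Reasoning
  ≢-as-xor : ∀ {a b c} → OneOf₃ a b c → a xor c ≡ true xor b
  ≢-as-xor first  = refl
  ≢-as-xor second = refl
  ≢-as-xor third  = refl
  ⨁-≡ : ⨁[ j < n ] does (i ≟ j) ≡ true
  ⨁-≡ = trans (𝔽₂.sum-cong-≗ {n} (λ j → sym (∧-identityʳ (does (i ≟ j))))) (⨁-δ i (λ _ → true))

⨁⨁-<-pairs : ∀ {n} → parity n ≡ true → (a : Fin n → Bool) →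
             ⨁[ i < n ] ⨁[ j < n ] (does (i <? j) ∧ (a i xor a j)) ≡ false
⨁⨁-<-pairs {n} n-odd a = begin
  ⨁[ i < n ] ⨁[ j < n ] (does (i <? j) ∧ (a i xor a j))
    ≡⟨ 𝔽₂.sum-cong-≗ {n} (λ i → 𝔽₂.sum-cong-≗ {n} (λ j →
         ∧-distribˡ-xor (does (i <? j)) (a i) (a j))) ⟩
  ⨁[ i < n ] ⨁[ j < n ] ((does (i <? j) ∧ a i) xor (does (i <? j) ∧ a j))
    ≡⟨ ⨁⨁-distrib-xor {n} {n} (λ i j → does (i <? j) ∧ a i) (λ i j → does (i <? j) ∧ a j) ⟩
  (⨁[ i < n ] ⨁[ j < n ] (does (i <? j) ∧ a i)) xor (⨁[ i < n ] ⨁[ j < n ] (does (i <? j) ∧ a j))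
    ≡⟨ cong ((⨁[ i < n ] ⨁[ j < n ] (does (i <? j) ∧ a i)) xor_)
            (𝔽₂.∑-comm {n} {n} (λ i j → does (i <? j) ∧ a j)) ⟩
  (⨁[ i < n ] ⨁[ j < n ] (does (i <? j) ∧ a i)) xor (⨁[ i < n ] ⨁[ j < n ] (does (j <? i) ∧ a i))
    ≡⟨ ⨁⨁-distrib-xor {n} {n} (λ i j → does (i <? j) ∧ a i) (λ i j → does (j <? i) ∧ a i) ⟨
  ⨁[ i < n ] ⨁[ j < n ] ((does (i <? j) ∧ a i) xor (does (j <? i) ∧ a i))
    ≡⟨ 𝔽₂.sum-cong-≗ {n} (λ i → sym (trans
         (𝔽₂.*-distribʳ-sum {n} (a i) (λ j → does (i <? j) xor does (j <? i)))
         (𝔽₂.sum-cong-≗ {n} (λ j → ∧-distribʳ-xor (a i) (does (i <? j)) (does (j <? i)))))) ⟩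
  ⨁[ i < n ] ((⨁[ j < n ] (does (i <? j) xor does (j <? i))) ∧ a i)
    ≡⟨ 𝔽₂.sum-cong-≗ {n} (λ i → cong (_∧ a i) (⨁-≢ n-odd i)) ⟩
  ⨁[ i < n ] false
    ≡⟨ 𝔽₂.sum-replicate-zero n ⟩
  false ∎
  where open ≡-Reasoning

injective⇒surjective : ∀ {n} {h : Fin n → Fin n} → Injective _≡_ _≡_ h → ∀ y → ∃ λ x → h x ≡ y
injective⇒surjective {suc n} {h} h-injective y with any? (λ x → h x ≟ y)
... | yes hit = hit
... | no miss = contradiction (injective⇒≤ h-y-injective) (<-irrefl refl)
  where
  y≢h : ∀ x → y ≢ h x
  y≢h x y≡hx = miss (x , sym y≡hx)
  h-y : Fin (suc n) → Fin n
  h-y x = punchOut (y≢h x)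
  h-y-injective : Injective _≡_ _≡_ h-y
  h-y-injective {x} {x′} eq = h-injective (punchOut-injective (y≢h x) (y≢h x′) eq)

injective⇒permutation : ∀ {n} {h : Fin n → Fin n} → Injective _≡_ _≡_ h → Permutation n n
injective⇒permutation {h = h} h-injective = permutation h
  (proj₁ ∘ injective⇒surjective h-injective)
  (proj₂ ∘ injective⇒surjective h-injective)
  (λ x → h-injective (proj₂ (injective⇒surjective h-injective (h x))))

module _ {n} {h : Fin n → Fin n} (h-injective : Injective _≡_ _≡_ h) where

  ⨁-reindex : (f : Fin n → Bool) → ⨁[ i < n ] f (h i) ≡ ⨁[ i < n ] f i
  ⨁-reindex f = sym (𝔽₂.sum-permute f (injective⇒permutation h-injective))

  count-reindex : (f : Fin n → Bool) → count (f ∘ h) ≡ count f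
  count-reindex f = sym (ℕΣ.sum-permute (𝟙 ∘ f) (injective⇒permutation h-injective))

  ∏-reindex : (f : Fin n → ℕ) → ∏ (f ∘ h) ≡ ∏ f
  ∏-reindex f = sym (ℕΠ.sum-permute f (injective⇒permutation h-injective))

module Involution {n} (σ : Fin n → Fin n) (σ-involutive : ∀ i → σ (σ i) ≡ i) where

  σ-injective : Injective _≡_ _≡_ σ
  σ-injective {i} {j} σi≡σj = trans (sym (σ-involutive i)) (trans (cong σ σi≡σj) (σ-involutive j))

  ⨁⨁-reindex : (H : Fin n → Fin n → Bool) →
               ⨁[ i < n ] ⨁[ j < n ] H i j ≡ ⨁[ i < n ] ⨁[ j < n ] H (σ j) (σ i)
  ⨁⨁-reindex H = begin
    ⨁[ i < n ] ⨁[ j < n ] H i j          ≡⟨ 𝔽₂.∑-comm {n} {n} H ⟩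
    ⨁[ j < n ] ⨁[ i < n ] H i j          ≡⟨ ⨁-reindex σ-injective (λ j → ⨁[ i < n ] H i j) ⟨
    ⨁[ j < n ] ⨁[ i < n ] H i (σ j)      ≡⟨ 𝔽₂.sum-cong-≗ {n} (λ j → ⨁-reindex σ-injective (λ i → H i (σ j))) ⟨
    ⨁[ j < n ] ⨁[ i < n ] H (σ i) (σ j)  ∎
    where open ≡-Reasoning

  -- Split each term according to how i compares with σ j: the pairs with σ j < i are the
  -- images under (i , j) ↦ (σ j , σ i) of those with i < σ j, so the two parts cancel.
  ⨁⨁-involution : (E : Fin n → Fin n → Bool) → (∀ i j → E (σ j) (σ i) ≡ E i j) →
                  ⨁[ i < n ] ⨁[ j < n ] E i j ≡ ⨁[ i < n ] E i (σ i)
  ⨁⨁-involution E E-symmetric = begin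
    ⨁[ i < n ] ⨁[ j < n ] E i j
      ≡⟨ 𝔽₂.sum-cong-≗ {n} (λ i → 𝔽₂.sum-cong-≗ {n} (λ j → xor-oneOf₃ (<-oneOf₃ i (σ j)) (E i j))) ⟩
    ⨁[ i < n ] ⨁[ j < n ] (below i j xor (on i j xor above i j))
      ≡⟨ ⨁⨁-distrib-xor below (λ i j → on i j xor above i j) ⟩
    Below xor (⨁[ i < n ] ⨁[ j < n ] (on i j xor above i j))
      ≡⟨ cong (Below xor_) (⨁⨁-distrib-xor on above) ⟩
    Below xor ((⨁[ i < n ] ⨁[ j < n ] on i j) xor (⨁[ i < n ] ⨁[ j < n ] above i j))
      ≡⟨ cong (Below xor_) (cong₂ _xor_ (𝔽₂.sum-cong-≗ {n} on-diagonal) above≡below) ⟩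
    Below xor ((⨁[ i < n ] E i (σ i)) xor Below)
      ≡⟨ xor-cancel Below (⨁[ i < n ] E i (σ i)) ⟩
    ⨁[ i < n ] E i (σ i) ∎
    where
    open ≡-Reasoning
    below on above : Fin n → Fin n → Bool
    below i j = does (i <? σ j) ∧ E i j
    on    i j = does (i ≟ σ j) ∧ E i j
    above i j = does (σ j <? i) ∧ E i j

    Below : Bool
    Below = ⨁[ i < n ] ⨁[ j < n ] below i j

    on-diagonal : ∀ i → ⨁[ j < n ] on i j ≡ E i (σ i)
    on-diagonal i = begin
      ⨁[ j < n ] on i j                            ≡⟨ ⨁-reindex σ-injective (on i) ⟨
      ⨁[ j < n ] (does (i ≟ σ (σ j)) ∧ E i (σ j))  ≡⟨ 𝔽₂.sum-cong-≗ {n} (λ j →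
                                                        cong (λ k → does (i ≟ k) ∧ E i (σ j)) (σ-involutive j)) ⟩
      ⨁[ j < n ] (does (i ≟ j) ∧ E i (σ j))        ≡⟨ ⨁-δ i (E i ∘ σ) ⟩
      E i (σ i)                                    ∎

    above≡below : ⨁[ i < n ] ⨁[ j < n ] above i j ≡ Below
    above≡below = trans (⨁⨁-reindex above) (𝔽₂.sum-cong-≗ {n} (λ i → 𝔽₂.sum-cong-≗ {n} (λ j →
      cong₂ (λ k e → does (k <? σ j) ∧ e) (σ-involutive i) (E-symmetric i j))))

  count-involution : (Φ : Fin n → Bool) → (∀ i → Φ (σ i) ≡ Φ i) →
                     count Φ ≡ count (λ i → does (i ≟ σ i) ∧ Φ i) + 2 * count (λ i → does (i <? σ i) ∧ Φ i)
  count-involution Φ Φ-invariant = begin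
    count Φ
      ≡⟨ ℕΣ.sum-cong-≗ {n} (λ i → 𝟙-oneOf₃ (<-oneOf₃ i (σ i)) (Φ i)) ⟩
    ∑ (λ i → 𝟙 (below i) + (𝟙 (on i) + 𝟙 (above i)))
      ≡⟨ ℕΣ.∑-distrib-+ {n} (𝟙 ∘ below) (λ i → 𝟙 (on i) + 𝟙 (above i)) ⟩
    count below + ∑ (λ i → 𝟙 (on i) + 𝟙 (above i))
      ≡⟨ cong (count below +_) (ℕΣ.∑-distrib-+ {n} (𝟙 ∘ on) (𝟙 ∘ above)) ⟩
    count below + (count on + count above)
      ≡⟨ cong (λ a → count below + (count on + a)) above≡below ⟩
    count below + (count on + count below)
      ≡⟨ rearrange (count below) (count on) ⟩
    count on + 2 * count below ∎
    where
    open ≡-Reasoning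
    below on above : Fin n → Bool
    below i = does (i <? σ i) ∧ Φ i
    on    i = does (i ≟ σ i) ∧ Φ i
    above i = does (σ i <? i) ∧ Φ i

    above≡below : count above ≡ count below
    above≡below = trans (sym (count-reindex σ-injective above)) (ℕΣ.sum-cong-≗ {n} (λ i →
      cong₂ (λ k b → 𝟙 (does (k <? σ i) ∧ b)) (σ-involutive i) (Φ-invariant i)))

    rearrange : ∀ a b → a + (b + a) ≡ b + 2 * a
    rearrange = solve-∀

  ⨁-lowerHalf : (Φ Ψ : Fin n → Bool) → (∀ i → Φ (σ i) ≡ Φ i) → (∀ i → Ψ (σ i) ≡ Ψ i) →
                (∀ i → i ≡ σ i → Φ i ≡ Ψ i) → count Φ ≡ count Ψ →
                ⨁[ i < n ] (does (i <? σ i) ∧ Φ i) ≡ ⨁[ i < n ] (does (i <? σ i) ∧ Ψ i)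
  ⨁-lowerHalf Φ Ψ Φ-invariant Ψ-invariant agree-on-fixed count-≡ = begin
    ⨁[ i < n ] (does (i <? σ i) ∧ Φ i)          ≡⟨ parity-count (λ i → does (i <? σ i) ∧ Φ i) ⟨
    parity (count (λ i → does (i <? σ i) ∧ Φ i)) ≡⟨ cong parity lowerHalf-counts ⟩
    parity (count (λ i → does (i <? σ i) ∧ Ψ i)) ≡⟨ parity-count (λ i → does (i <? σ i) ∧ Ψ i) ⟩
    ⨁[ i < n ] (does (i <? σ i) ∧ Ψ i)          ∎
    where
    open ≡-Reasoning
    fixed-parts : ∀ i → 𝟙 (does (i ≟ σ i) ∧ Φ i) ≡ 𝟙 (does (i ≟ σ i) ∧ Ψ i)
    fixed-parts i with i ≟ σ i
    ... | yes i≡σi = cong 𝟙 (agree-on-fixed i i≡σi)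
    ... | no  _    = refl

    lowerHalf-counts : count (λ i → does (i <? σ i) ∧ Φ i) ≡ count (λ i → does (i <? σ i) ∧ Ψ i)
    lowerHalf-counts = *-cancelˡ-≡ _ _ 2 (+-cancelˡ-≡ (count (λ i → does (i ≟ σ i) ∧ Φ i)) _ _ (begin
      count (λ i → does (i ≟ σ i) ∧ Φ i) + 2 * count (λ i → does (i <? σ i) ∧ Φ i)
        ≡⟨ count-involution Φ Φ-invariant ⟨
      count Φ
        ≡⟨ count-≡ ⟩
      count Ψ
        ≡⟨ count-involution Ψ Ψ-invariant ⟩
      count (λ i → does (i ≟ σ i) ∧ Ψ i) + 2 * count (λ i → does (i <? σ i) ∧ Ψ i)
        ≡⟨ cong (_+ _) (ℕΣ.sum-cong-≗ {n} fixed-parts) ⟨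
      count (λ i → does (i ≟ σ i) ∧ Φ i) + 2 * count (λ i → does (i <? σ i) ∧ Ψ i) ∎))

-- Negation and translation modulo n

neg : ∀ {n} → Fin (suc n) → Fin (suc n)
neg zero    = zero
neg (suc i) = suc (opposite i)

neg-involutive : ∀ {n} (x : Fin (suc n)) → neg (neg x) ≡ x
neg-involutive zero    = refl
neg-involutive (suc i) = cong suc (opposite-involutive i)

toℕ-neg : ∀ {n} (x : Fin (suc n)) → x ≢ zero → toℕ (neg x) ≡ suc n ∸ toℕ x
toℕ-neg     zero    x≢0 = contradiction refl x≢0
toℕ-neg {n} (suc i) _   = begin
  suc (toℕ (opposite i))  ≡⟨ cong suc (opposite-prop i) ⟩
  suc (n ∸ suc (toℕ i))   ≡⟨ +-∸-assoc 1 (toℕ<n i) ⟨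
  n ∸ toℕ i               ∎
  where open ≡-Reasoning

neg-reverses-< : ∀ {n} {x y : Fin (suc n)} → x ≢ zero → y ≢ zero → does (neg x <? neg y) ≡ does (y <? x)
neg-reverses-< {x = zero}          x≢0 _   = contradiction refl x≢0
neg-reverses-< {x = suc _} {zero}  _   y≢0 = contradiction refl y≢0
neg-reverses-< {n} {suc i} {suc j} _   _   =
  does-⇔ (mk⇔ reflect reverse) (neg (suc i) <? neg (suc j)) (suc j <? suc i)
  where
  reflect : suc (toℕ (opposite i)) < suc (toℕ (opposite j)) → suc (toℕ j) < suc (toℕ i)
  reflect lt = ∸-cancelʳ-< {o = n} (subst₂ _<_ (opposite-prop i) (opposite-prop j) (s≤s⁻¹ lt))
  reverse : suc (toℕ j) < suc (toℕ i) → suc (toℕ (opposite i)) < suc (toℕ (opposite j))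
  reverse lt = s≤s (subst₂ _<_ (sym (opposite-prop i)) (sym (opposite-prop j)) (∸-monoʳ-< lt (toℕ<n i)))

neg-fixed⇒zero : ∀ {m} (x : Fin (suc (m + m))) → neg x ≡ x → x ≡ zero
neg-fixed⇒zero     zero    _         = refl
neg-fixed⇒zero {m} (suc i) neg-fixed = contradiction false≡true λ ()
  where
  open ≡-Reasoning
  opposite-fixed : toℕ (opposite i) ≡ toℕ i
  opposite-fixed = cong toℕ (Fin-suc-injective neg-fixed)
  m+m≡1+2i : m + m ≡ suc (toℕ i + toℕ i)
  m+m≡1+2i = begin
    m + m                                ≡⟨ m∸n+n≡m (toℕ<n i) ⟨
    (m + m ∸ suc (toℕ i)) + suc (toℕ i)  ≡⟨ cong (_+ suc (toℕ i)) (trans (sym (opposite-prop i)) opposite-fixed) ⟩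
    toℕ i + suc (toℕ i)                  ≡⟨ +-suc (toℕ i) (toℕ i) ⟩
    suc (toℕ i + toℕ i)                  ∎
  false≡true : false ≡ true
  false≡true = begin
    false                         ≡⟨ parity-double m ⟨
    parity (m + m)                ≡⟨ cong parity m+m≡1+2i ⟩
    not (parity (toℕ i + toℕ i))  ≡⟨ cong not (parity-double (toℕ i)) ⟩
    true                          ∎

-- For n + 1 = 2m + 1, lower x holds iff 1 ≤ x ≤ m and upper x holds iff m < x.
lower upper : ∀ {n} → Fin (suc n) → Bool
lower x = does (x <? neg x)
upper x = does (neg x <? x)

lower≡not-upper : ∀ {m} (x : Fin (suc (m + m))) → x ≢ zero → lower x ≡ not (upper x)
lower≡not-upper {m} x x≢0 = first≡not-third (<-oneOf₃ x (neg x)) x≢neg-x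
  where
  x≢neg-x : does (x ≟ neg x) ≡ false
  x≢neg-x = dec-false (x ≟ neg x) (λ x≡-x → x≢0 (neg-fixed⇒zero {m} x (sym x≡-x)))
  first≡not-third : ∀ {a b c} → OneOf₃ a b c → b ≡ false → a ≡ not c
  first≡not-third first _ = refl
  first≡not-third third _ = refl

inversionParity-neg : ∀ {n} {h : Fin (suc n) → Fin (suc n)} → Injective _≡_ _≡_ h → h zero ≡ zero →
                      (∀ x → h (neg x) ≡ neg (h x)) →
                      inversionParity h ≡ ⨁[ i < suc n ] (lower i ∧ upper (h i))
inversionParity-neg {n} {h} h-injective h-zero h-neg = begin
  inversionParity h                                  ≡⟨ ⨁⨁-involution E E-symmetric ⟩
  ⨁[ i < suc n ] (lower i ∧ does (h (neg i) <? h i))  ≡⟨ 𝔽₂.sum-cong-≗ {suc n} (λ i →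
                                                          cong (λ y → lower i ∧ does (y <? h i)) (h-neg i)) ⟩
  ⨁[ i < suc n ] (lower i ∧ upper (h i))             ∎
  where
  open ≡-Reasoning
  open Involution (neg {n}) neg-involutive

  E : Fin (suc n) → Fin (suc n) → Bool
  E i j = does (i <? j) ∧ does (h j <? h i)

  h-suc≢0 : ∀ i → h (suc i) ≢ zero
  h-suc≢0 i hi≡0 with h-injective (trans hi≡0 (sym h-zero))
  ... | ()

  E-symmetric : ∀ i j → E (neg j) (neg i) ≡ E i j
  E-symmetric zero    j       rewrite h-zero = sym (∧-zeroʳ _)
  E-symmetric (suc i) zero    rewrite h-zero = refl
  E-symmetric (suc i) (suc j) = cong₂ _∧_ (neg-reverses-< {x = suc j} {suc i} (λ ()) (λ ())) (begin
    does (h (neg (suc i)) <? h (neg (suc j)))  ≡⟨ cong₂ (λ x y → does (x <? y)) (h-neg (suc i)) (h-neg (suc j)) ⟩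
    does (neg (h (suc i)) <? neg (h (suc j)))  ≡⟨ neg-reverses-< (h-suc≢0 i) (h-suc≢0 j) ⟩
    does (h (suc j) <? h (suc i))              ∎)

module _ {N c : ℕ} .{{_ : NonZero N}} where

  wrapped<c : ∀ {x} → x < N → N ≤ x + c → x + c ∸ N < c
  wrapped<c {x} x<N N≤x+c = subst (x + c ∸ N <_) (m+n∸n≡m c N)
    (∸-monoˡ-< (subst (x + c <_) (+-comm N c) (+-monoˡ-< c x<N)) N≤x+c)

  %-wrapped : ∀ {x} → x < N → c < N → N ≤ x + c → (x + c) % N ≡ x + c ∸ N
  %-wrapped x<N c<N N≤x+c =
    trans (sym (m≤n⇒[n∸m]%m≡n%m N≤x+c)) (m<n⇒m%n≡m (<-trans (wrapped<c x<N N≤x+c) c<N))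

  %-shift-< : ∀ {u v} → u < N → v < N → c < N →
              does ((v + c) % N ℕ.<? (u + c) % N)
                ≡ does (v ℕ.<? u) xor (does (N ℕ.≤? u + c) xor does (N ℕ.≤? v + c))
  %-shift-< {u} {v} u<N v<N c<N with N ℕ.≤? u + c | N ℕ.≤? v + c
  ... | yes u-wraps | yes v-wraps
    rewrite %-wrapped u<N c<N u-wraps | %-wrapped v<N c<N v-wraps
          | dec-true (N ℕ.≤? u + c) u-wraps | dec-true (N ℕ.≤? v + c) v-wraps
    = trans (does-⇔ (mk⇔ reflect reverse) (v + c ∸ N ℕ.<? u + c ∸ N) (v ℕ.<? u))
            (sym (xor-identityʳ (does (v ℕ.<? u))))
    where
    reflect : v + c ∸ N < u + c ∸ N → v < u
    reflect lt = +-cancelʳ-< c v u (subst₂ _<_ (m∸n+n≡m v-wraps) (m∸n+n≡m u-wraps) (+-monoˡ-< N lt))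
    reverse : v < u → v + c ∸ N < u + c ∸ N
    reverse v<u = ∸-monoˡ-< (+-monoˡ-< c v<u) v-wraps
  ... | yes u-wraps | no ¬v-wraps
    rewrite %-wrapped u<N c<N u-wraps | m<n⇒m%n≡m (≰⇒> ¬v-wraps)
          | dec-true (N ℕ.≤? u + c) u-wraps | dec-false (N ℕ.≤? v + c) ¬v-wraps
          | dec-false (v + c ℕ.<? u + c ∸ N) (λ lt → <-asym lt (<-≤-trans (wrapped<c u<N u-wraps) (m≤n+m c v)))
          | dec-true (v ℕ.<? u) (+-cancelʳ-< c v u (<-≤-trans (≰⇒> ¬v-wraps) u-wraps))
    = refl
  ... | no ¬u-wraps | yes v-wraps
    rewrite m<n⇒m%n≡m (≰⇒> ¬u-wraps) | %-wrapped v<N c<N v-wraps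
          | dec-false (N ℕ.≤? u + c) ¬u-wraps | dec-true (N ℕ.≤? v + c) v-wraps
          | dec-true (v + c ∸ N ℕ.<? u + c) (<-≤-trans (wrapped<c v<N v-wraps) (m≤n+m c u))
          | dec-false (v ℕ.<? u) (<-asym (+-cancelʳ-< c u v (<-≤-trans (≰⇒> ¬u-wraps) v-wraps)))
    = refl
  ... | no ¬u-wraps | no ¬v-wraps
    rewrite m<n⇒m%n≡m (≰⇒> ¬u-wraps) | m<n⇒m%n≡m (≰⇒> ¬v-wraps)
          | dec-false (N ℕ.≤? u + c) ¬u-wraps | dec-false (N ℕ.≤? v + c) ¬v-wraps
    = trans (does-⇔ (mk⇔ (+-cancelʳ-< c v u) (+-monoˡ-< c)) (v + c ℕ.<? u + c) (v ℕ.<? u))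
            (sym (xor-identityʳ (does (v ℕ.<? u))))

shift : ∀ {n} → Fin (suc n) → Fin (suc n) → Fin (suc n)
shift {n} c x = (toℕ x + toℕ c) mod suc n

toℕ-shift : ∀ {n} (c x : Fin (suc n)) → toℕ (shift c x) ≡ (toℕ x + toℕ c) % suc n
toℕ-shift c x = toℕ-fromℕ< _

wraps : ∀ {n} → Fin (suc n) → Fin (suc n) → Bool
wraps {n} c x = does (suc n ℕ.≤? toℕ x + toℕ c)

shift-< : ∀ {n} (c x y : Fin (suc n)) →
          does (shift c y <? shift c x) ≡ does (y <? x) xor (wraps c x xor wraps c y)
shift-< c x y = trans (cong₂ (λ a b → does (a ℕ.<? b)) (toℕ-shift c y) (toℕ-shift c x))
                      (%-shift-< (toℕ<n x) (toℕ<n y) (toℕ<n c))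

inversionParity-shift : ∀ {n} → parity (suc n) ≡ true → (c : Fin (suc n)) (h : Fin (suc n) → Fin (suc n)) →
                        inversionParity (shift c ∘ h) ≡ inversionParity h
inversionParity-shift {n} n-odd c h = begin
  inversionParity (shift c ∘ h)
    ≡⟨ 𝔽₂.sum-cong-≗ {suc n} (λ i → 𝔽₂.sum-cong-≗ {suc n} (λ j →
         trans (cong (does (i <? j) ∧_) (shift-< c (h i) (h j)))
               (∧-distribˡ-xor (does (i <? j)) (does (h j <? h i)) (wraps c (h i) xor wraps c (h j))))) ⟩
  ⨁[ i < suc n ] ⨁[ j < suc n ] ((does (i <? j) ∧ does (h j <? h i)) xor (does (i <? j) ∧ (w i xor w j)))
    ≡⟨ ⨁⨁-distrib-xor (λ i j → does (i <? j) ∧ does (h j <? h i)) (λ i j → does (i <? j) ∧ (w i xor w j)) ⟩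
  inversionParity h xor (⨁[ i < suc n ] ⨁[ j < suc n ] (does (i <? j) ∧ (w i xor w j)))
    ≡⟨ cong (inversionParity h xor_) (⨁⨁-<-pairs n-odd w) ⟩
  inversionParity h xor false
    ≡⟨ xor-identityʳ (inversionParity h) ⟩
  inversionParity h ∎
  where
  open ≡-Reasoning
  w : Fin (suc n) → Bool
  w = wraps c ∘ h

-- Arithmetic modulo a prime

module Congruence (p : ℕ) .{{_ : NonZero p}} where

  infix 4 _≈_
  record _≈_ (a b : ℕ) : Set where
    constructor mk≈
    field %-≡ : a % p ≡ b % p
  open _≈_ public

  ≈-setoid : Setoid _ _
  ≈-setoid = record
    { Carrier       = ℕ
    ; _≈_           = _≈_
    ; isEquivalence = record
      { refl  = mk≈ refl
      ; sym   = λ a≈b → mk≈ (sym (%-≡ a≈b))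
      ; trans = λ a≈b b≈c → mk≈ (trans (%-≡ a≈b) (%-≡ b≈c))
      }
    }

  open Setoid ≈-setoid public
    using () renaming (refl to ≈-refl; sym to ≈-sym; trans to ≈-trans; reflexive to ≡⇒≈)
  module ≈-Reasoning = SetoidReasoning ≈-setoid

  %-≈ : ∀ a → a % p ≈ a
  %-≈ a = mk≈ (m%n%n≡m%n a p)

  +-cong : ∀ {a b c d} → a ≈ b → c ≈ d → a + c ≈ b + d
  +-cong {a} {b} {c} {d} a≈b c≈d = mk≈ (begin
    (a + c) % p            ≡⟨ %-distribˡ-+ a c p ⟩
    (a % p + c % p) % p    ≡⟨ cong₂ (λ x y → (x + y) % p) (%-≡ a≈b) (%-≡ c≈d) ⟩
    (b % p + d % p) % p    ≡⟨ %-distribˡ-+ b d p ⟨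
    (b + d) % p            ∎)
    where open ≡-Reasoning

  *-cong : ∀ {a b c d} → a ≈ b → c ≈ d → a * c ≈ b * d
  *-cong {a} {b} {c} {d} a≈b c≈d = mk≈ (begin
    (a * c) % p            ≡⟨ %-distribˡ-* a c p ⟩
    (a % p * (c % p)) % p  ≡⟨ cong₂ (λ x y → (x * y) % p) (%-≡ a≈b) (%-≡ c≈d) ⟩
    (b % p * (d % p)) % p  ≡⟨ %-distribˡ-* b d p ⟨
    (b * d) % p            ∎)
    where open ≡-Reasoning

  ^-cong : ∀ {a b} → a ≈ b → ∀ e → a ^ e ≈ b ^ e
  ^-cong a≈b zero    = ≈-refl
  ^-cong a≈b (suc e) = *-cong a≈b (^-cong a≈b e)

  ≈⇒%≡ : ∀ {a b} → b < p → a ≈ b → a % p ≡ b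
  ≈⇒%≡ b<p a≈b = trans (%-≡ a≈b) (m<n⇒m%n≡m b<p)

  ≈⇒≡ : ∀ {a b} → a < p → b < p → a ≈ b → a ≡ b
  ≈⇒≡ a<p b<p a≈b = trans (sym (m<n⇒m%n≡m a<p)) (≈⇒%≡ b<p a≈b)

  ≈0⇒∣ : ∀ {a} → a ≈ 0 → p ∣ a
  ≈0⇒∣ {a} a≈0 = m%n≡0⇒n∣m a p (≈⇒%≡ (>-nonZero⁻¹ p) a≈0)

  ≈⇒∣∸ : ∀ {a b} → a ≈ b → p ∣ b ∸ a
  ≈⇒∣∸ {a} {b} a≈b = divides (b / p ∸ a / p) (begin
    b ∸ a                                      ≡⟨ cong₂ _∸_ (m≡m%n+[m/n]*n b p) (m≡m%n+[m/n]*n a p) ⟩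
    (b % p + b / p * p) ∸ (a % p + a / p * p)  ≡⟨ cong (λ r → (b % p + b / p * p) ∸ (r + a / p * p)) (%-≡ a≈b) ⟩
    (b % p + b / p * p) ∸ (b % p + a / p * p)  ≡⟨ [m+n]∸[m+o]≡n∸o (b % p) (b / p * p) (a / p * p) ⟩
    b / p * p ∸ a / p * p                      ≡⟨ *-distribʳ-∸ p (b / p) (a / p) ⟨
    (b / p ∸ a / p) * p                        ∎)
    where open ≡-Reasoning

  ∣∸⇒≈ : ∀ {a b} → a ≤ b → p ∣ b ∸ a → a ≈ b
  ∣∸⇒≈ {a} {b} a≤b (divides q b∸a≡q*p) = mk≈ (sym (begin
    b % p            ≡⟨ cong (_% p) (m∸n+n≡m a≤b) ⟨
    (b ∸ a + a) % p  ≡⟨ cong (λ r → (r + a) % p) b∸a≡q*p ⟩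
    (q * p + a) % p  ≡⟨ cong (_% p) (+-comm (q * p) a) ⟩
    (a + q * p) % p  ≡⟨ [m+kn]%n≡m%n a q p ⟩
    a % p            ∎))
    where open ≡-Reasoning

  wlog-≤ : (R : ℕ → ℕ → Set) → (∀ {a b} → R a b → R b a) → (∀ {a b} → a ≤ b → R a b → a ≈ b) →
           ∀ {a b} → R a b → a ≈ b
  wlog-≤ R R-sym ≤-case {a} {b} r with ≤-total a b
  ... | inj₁ a≤b = ≤-case a≤b r
  ... | inj₂ b≤a = ≈-sym (≤-case b≤a (R-sym r))

  +-cancelʳ-≈ : ∀ {a b} c → a + c ≈ b + c → a ≈ b
  +-cancelʳ-≈ c = wlog-≤ (λ a b → a + c ≈ b + c) ≈-sym λ {a} {b} a≤b a+c≈b+c →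
    ∣∸⇒≈ a≤b (subst (p ∣_) (trans (cong₂ _∸_ (+-comm b c) (+-comm a c)) ([m+n]∸[m+o]≡n∸o c b a))
                         (≈⇒∣∸ a+c≈b+c))

shift-injective : ∀ {n} (c : Fin (suc n)) → Injective _≡_ _≡_ (shift c)
shift-injective {n} c {x} {y} cx≡cy = toℕ-injective (≈⇒≡ (toℕ<n x) (toℕ<n y) (+-cancelʳ-≈ (toℕ c)
  (mk≈ (trans (sym (toℕ-shift c x)) (trans (cong toℕ cx≡cy) (toℕ-shift c y))))))
  where open Congruence (suc n)

^-distrib-* : ∀ a b e → (a * b) ^ e ≡ a ^ e * b ^ e
^-distrib-* a b zero    = refl
^-distrib-* a b (suc e) = trans (cong (a * b *_) (^-distrib-* a b e)) (interchange a b (a ^ e) (b ^ e))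
  where
  interchange : ∀ a b c d → a * b * (c * d) ≡ a * c * (b * d)
  interchange = solve-∀

∏-const : ∀ n a → ∏ {n} (λ _ → a) ≡ a ^ n
∏-const zero    a = refl
∏-const (suc n) a = cong (a *_) (∏-const n a)

module PrimeModulus {ν : ℕ} (prime : Prime (suc ν)) where

  p : ℕ
  p = suc ν

  open Congruence p public

  1<p : 1 < p
  1<p = nonTrivial⇒n>1 p {{prime⇒nonTrivial prime}}

  p∤1 : ¬ p ∣ 1
  p∤1 p∣1 = nonTrivial⇒≢1 {{prime⇒nonTrivial prime}} (∣1⇒≡1 p∣1)

  ∤-* : ∀ {a b} → ¬ p ∣ a → ¬ p ∣ b → ¬ p ∣ a * b
  ∤-* {a} {b} p∤a p∤b p∣ab = [ p∤a , p∤b ]′ (euclidsLemma a b prime p∣ab)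

  ∤-^ : ∀ {a} → ¬ p ∣ a → ∀ e → ¬ p ∣ a ^ e
  ∤-^ p∤a zero    = p∤1
  ∤-^ p∤a (suc e) = ∤-* p∤a (∤-^ p∤a e)

  ∤-∏ : ∀ {n} (f : Fin n → ℕ) → (∀ i → ¬ p ∣ f i) → ¬ p ∣ ∏ f
  ∤-∏ {zero}  f p∤f = p∤1
  ∤-∏ {suc n} f p∤f = ∤-* (p∤f zero) (∤-∏ (f ∘ suc) (p∤f ∘ suc))

  ∤-toℕ : ∀ (x : Fin p) → x ≢ zero → ¬ p ∣ toℕ x
  ∤-toℕ zero    x≢0 = contradiction refl x≢0
  ∤-toℕ (suc i) _   = >⇒∤ (s≤s (toℕ<n i))

  ∏-cong : ∀ {n} {f g : Fin n → ℕ} → (∀ i → f i ≈ g i) → ∏ f ≈ ∏ g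
  ∏-cong {zero}  f≈g = ≈-refl
  ∏-cong {suc n} f≈g = *-cong (f≈g zero) (∏-cong (f≈g ∘ suc))

  *-cancelˡ-≈ : ∀ {a b c} → ¬ p ∣ c → c * a ≈ c * b → a ≈ b
  *-cancelˡ-≈ {c = c} p∤c = wlog-≤ (λ a b → c * a ≈ c * b) ≈-sym λ {a} {b} a≤b ca≈cb →
    ∣∸⇒≈ a≤b ([ (λ p∣c → contradiction p∣c p∤c) , id ]′
               (euclidsLemma c (b ∸ a) prime (subst (p ∣_) (sym (*-distribˡ-∸ c b a)) (≈⇒∣∸ ca≈cb))))

  module _ {a : ℕ} (p∤a : ¬ p ∣ a) where

    scale : Fin p → Fin p
    scale x = (toℕ x * a) mod p

    toℕ-scale : ∀ x → toℕ (scale x) ≡ (toℕ x * a) % p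
    toℕ-scale x = toℕ-fromℕ< _

    scale-injective : Injective _≡_ _≡_ scale
    scale-injective {x} {y} ax≡ay = toℕ-injective (≈⇒≡ (toℕ<n x) (toℕ<n y) (*-cancelˡ-≈ p∤a (mk≈ (begin
      (a * toℕ x) % p  ≡⟨ cong (_% p) (*-comm a (toℕ x)) ⟩
      (toℕ x * a) % p  ≡⟨ trans (sym (toℕ-scale x)) (trans (cong toℕ ax≡ay) (toℕ-scale y)) ⟩
      (toℕ y * a) % p  ≡⟨ cong (_% p) (*-comm (toℕ y) a) ⟩
      (a * toℕ y) % p  ∎))))
      where open ≡-Reasoning

    scale-zero : scale zero ≡ zero
    scale-zero = toℕ-injective (toℕ-scale zero)

    scale-suc≢0 : ∀ i → scale (suc i) ≢ zero
    scale-suc≢0 i ai≡0 = ∤-* (∤-toℕ (suc i) (λ ())) p∤a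
      (m%n≡0⇒n∣m _ p (trans (sym (toℕ-scale (suc i))) (cong toℕ ai≡0)))

  unit : Fin p → ℕ
  unit zero    = 1
  unit (suc i) = suc (toℕ i)

  unit-scale-suc : ∀ {a} (p∤a : ¬ p ∣ a) i → unit (scale p∤a (suc i)) ≈ suc (toℕ i) * a
  unit-scale-suc {a} p∤a i with scale p∤a (suc i) | scale-suc≢0 p∤a i | toℕ-scale p∤a (suc i)
  ... | zero  | ≢0 | _  = contradiction refl ≢0
  ... | suc _ | _  | eq = ≈-trans (≡⇒≈ eq) (%-≈ (suc (toℕ i) * a))

  -- Multiplication by a permutes the non-zero residues, so it leaves their product unchanged.
  fermat : ∀ {a} → ¬ p ∣ a → a ^ ν ≈ 1
  fermat {a} p∤a = ≈-sym (*-cancelˡ-≈ (∤-∏ (λ i → suc (toℕ i)) (λ i → ∤-toℕ (suc i) (λ ()))) (begin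
    W * 1                                  ≡⟨ *-identityʳ W ⟩
    W                                      ≡⟨ *-identityˡ W ⟨
    ∏ unit                                 ≡⟨ ∏-reindex (scale-injective p∤a) unit ⟨
    ∏ (unit ∘ scale p∤a)                   ≡⟨ cong (λ y → unit y * ∏ (unit ∘ scale p∤a ∘ suc)) (scale-zero p∤a) ⟩
    1 * ∏ (unit ∘ scale p∤a ∘ suc)         ≡⟨ *-identityˡ _ ⟩
    ∏ (unit ∘ scale p∤a ∘ suc)             ≈⟨ ∏-cong {ν} (unit-scale-suc p∤a) ⟩
    ∏ {ν} (λ i → suc (toℕ i) * a)          ≡⟨ ℕΠ.∑-distrib-+ {ν} (λ i → suc (toℕ i)) (λ _ → a) ⟩
    W * ∏ {ν} (λ _ → a)                    ≡⟨ cong (W *_) (∏-const ν a) ⟩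
    W * a ^ ν                              ∎))
    where
    open ≈-Reasoning
    W : ℕ
    W = ∏ {ν} (λ i → suc (toℕ i))

  a^[kν]≈1 : ∀ {a} → ¬ p ∣ a → ∀ k → a ^ (k * ν) ≈ 1
  a^[kν]≈1 {a} p∤a k = begin
    a ^ (k * ν)  ≡⟨ cong (a ^_) (*-comm k ν) ⟩
    a ^ (ν * k)  ≡⟨ ^-*-assoc a ν k ⟨
    (a ^ ν) ^ k  ≈⟨ ^-cong (fermat p∤a) k ⟩
    1 ^ k        ≡⟨ ^-zeroˡ k ⟩
    1            ∎
    where open ≈-Reasoning

  ^-injective : ∀ {d} → gcd d ν ≡ 1 → ∀ {x y} → ¬ p ∣ x → ¬ p ∣ y → x ^ d ≈ y ^ d → x ≈ y
  ^-injective {d} coprime {x} {y} p∤x p∤y xᵈ≈yᵈ with bézout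
    where
    bézout : Bézout.Identity 1 d ν
    bézout = subst (λ g → Bézout.Identity g d ν) coprime (Bézout.identity (gcd-GCD d ν))
  ... | Bézout.+- X Y 1+Yν≡Xd = begin
    x            ≈⟨ root x p∤x ⟨
    (x ^ d) ^ X  ≈⟨ ^-cong xᵈ≈yᵈ X ⟩
    (y ^ d) ^ X  ≈⟨ root y p∤y ⟩
    y            ∎
    where
    open ≈-Reasoning
    root : ∀ z → ¬ p ∣ z → (z ^ d) ^ X ≈ z
    root z p∤z = begin
      (z ^ d) ^ X      ≡⟨ ^-*-assoc z d X ⟩
      z ^ (d * X)      ≡⟨ cong (z ^_) (trans (*-comm d X) (sym 1+Yν≡Xd)) ⟩
      z * z ^ (Y * ν)  ≈⟨ *-cong (≈-refl {z}) (a^[kν]≈1 p∤z Y) ⟩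
      z * 1            ≡⟨ *-identityʳ z ⟩
      z                ∎
  ... | Bézout.-+ X Y 1+Xd≡Yν = *-cancelˡ-≈ (∤-^ (∤-^ p∤x d) X) (begin
    (x ^ d) ^ X * x  ≡⟨ *-comm _ x ⟩
    x * (x ^ d) ^ X  ≈⟨ inverse x p∤x ⟩
    1                ≈⟨ inverse y p∤y ⟨
    y * (y ^ d) ^ X  ≈⟨ *-cong (≈-refl {y}) (^-cong xᵈ≈yᵈ X) ⟨
    y * (x ^ d) ^ X  ≡⟨ *-comm y _ ⟩
    (x ^ d) ^ X * y  ∎)
    where
    open ≈-Reasoning
    inverse : ∀ z → ¬ p ∣ z → z * (z ^ d) ^ X ≈ 1
    inverse z p∤z = begin
      z * (z ^ d) ^ X  ≡⟨ cong (z *_) (^-*-assoc z d X) ⟩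
      z ^ suc (d * X)  ≡⟨ cong (λ e → z ^ suc e) (*-comm d X) ⟩
      z ^ (1 + X * d)  ≡⟨ cong (z ^_) 1+Xd≡Yν ⟩
      z ^ (Y * ν)      ≈⟨ a^[kν]≈1 p∤z Y ⟩
      1                ∎

  -- ν = p - 1 plays the role of -1.
  k*p≈0 : ∀ k → k * p ≈ 0
  k*p≈0 k = mk≈ (m*n%n≡0 k p)

  p∸x≈ν*x : ∀ {x} → x ≤ p → p ∸ x ≈ ν * x
  p∸x≈ν*x {x} x≤p = +-cancelʳ-≈ x (begin
    p ∸ x + x  ≡⟨ m∸n+n≡m x≤p ⟩
    p          ≡⟨ *-identityˡ p ⟨
    1 * p      ≈⟨ k*p≈0 1 ⟩
    0          ≈⟨ k*p≈0 x ⟨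
    x * p      ≡⟨ *-comm x p ⟩
    x + ν * x  ≡⟨ +-comm x (ν * x) ⟩
    ν * x + x  ∎)
    where open ≈-Reasoning

  ν*ν≈1 : ν * ν ≈ 1
  ν*ν≈1 = +-cancelʳ-≈ ν (begin
    ν * ν + ν  ≡⟨ +-comm (ν * ν) ν ⟩
    ν + ν * ν  ≡⟨ *-suc ν ν ⟨
    ν * p      ≈⟨ k*p≈0 ν ⟩
    0          ≈⟨ k*p≈0 1 ⟨
    1 * p      ≡⟨ *-identityˡ p ⟩
    1 + ν      ∎)
    where open ≈-Reasoning

  ν^e≈ν-or-1 : ∀ e → ν ^ e ≈ (if parity e then ν else 1)
  ν^e≈ν-or-1 zero    = ≈-refl
  ν^e≈ν-or-1 (suc e) with parity e | ν^e≈ν-or-1 e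
  ... | true  | νᵉ≈ν = ≈-trans (*-cong (≈-refl {ν}) νᵉ≈ν) ν*ν≈1
  ... | false | νᵉ≈1 = ≈-trans (*-cong (≈-refl {ν}) νᵉ≈1) (≡⇒≈ (*-identityʳ ν))

  ν^odd≈ν : ∀ {e} → parity e ≡ true → ν ^ e ≈ ν
  ν^odd≈ν {e} e-odd = ≈-trans (ν^e≈ν-or-1 e) (≡⇒≈ (cong (if_then ν else 1) e-odd))

  [p∸x]^odd≈ν*x^odd : ∀ {x e} → x ≤ p → parity e ≡ true → (p ∸ x) ^ e ≈ ν * x ^ e
  [p∸x]^odd≈ν*x^odd {x} {e} x≤p e-odd = begin
    (p ∸ x) ^ e    ≈⟨ ^-cong (p∸x≈ν*x x≤p) e ⟩
    (ν * x) ^ e    ≡⟨ ^-distrib-* ν x e ⟩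
    ν ^ e * x ^ e  ≈⟨ *-cong (ν^odd≈ν {e} e-odd) (≈-refl {x ^ e}) ⟩
    ν * x ^ e      ∎
    where open ≈-Reasoning

  square≈1⇒±1 : ∀ {t} → t < p → t * t ≈ 1 → t ≡ 1 ⊎ t ≡ ν
  square≈1⇒±1 {zero}  _   0≈1 = contradiction (≈0⇒∣ (≈-sym 0≈1)) p∤1
  square≈1⇒±1 {suc s} t<p t²≈1
    with euclidsLemma s (2 + s) prime (subst (p ∣_) (factor s) (≈⇒∣∸ (≈-sym t²≈1)))
    where
    factor : ∀ s → s + s * suc s ≡ s * (2 + s)
    factor = solve-∀
  ... | inj₁ p∣s   = inj₁ (cong suc (p∣s⇒s≡0 s (<-trans (n<1+n s) t<p) p∣s))
    where
    p∣s⇒s≡0 : ∀ s → s < p → p ∣ s → s ≡ 0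
    p∣s⇒s≡0 zero    _   _   = refl
    p∣s⇒s≡0 (suc s) s<p p∣s = contradiction p∣s (>⇒∤ s<p)
  ... | inj₂ p∣2+s = inj₂ (suc-injective (≤-antisym t<p (∣⇒≤ p∣2+s)))

-- The power map x ↦ x ^ d

module PowerMap (m : ℕ) (prime : Prime (suc (m + m))) (d : ℕ) (coprime : gcd d (m + m) ≡ 1) where

  open PrimeModulus prime

  ν : ℕ
  ν = m + m

  d-odd : parity d ≡ true
  d-odd = coprime-to-even⇒odd {d} m coprime

  pow : Fin p → Fin p
  pow x = (toℕ x ^ d) mod p

  toℕ-pow : ∀ x → toℕ (pow x) ≡ toℕ x ^ d % p
  toℕ-pow x = toℕ-fromℕ< _

  pow-zero : pow zero ≡ zero
  pow-zero = toℕ-injective (trans (toℕ-pow zero) (cong (_% p) (0^odd d d-odd)))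
    where
    0^odd : ∀ e → parity e ≡ true → 0 ^ e ≡ 0
    0^odd (suc e) _ = refl

  pow-≢0 : ∀ {x} → x ≢ zero → pow x ≢ zero
  pow-≢0 {x} x≢0 powx≡0 =
    ∤-^ (∤-toℕ x x≢0) d (m%n≡0⇒n∣m _ p (trans (sym (toℕ-pow x)) (cong toℕ powx≡0)))

  pow-injective : Injective _≡_ _≡_ pow
  pow-injective {x} {y} powx≡powy with x ≟ zero | y ≟ zero
  ... | yes refl | yes refl = refl
  ... | yes refl | no  y≢0  = contradiction (trans (sym powx≡powy) pow-zero) (pow-≢0 y≢0)
  ... | no  x≢0  | yes refl = contradiction (trans powx≡powy pow-zero) (pow-≢0 x≢0)
  ... | no  x≢0  | no  y≢0  = toℕ-injective (≈⇒≡ (toℕ<n x) (toℕ<n y)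
    (^-injective {d} coprime (∤-toℕ x x≢0) (∤-toℕ y y≢0)
      (mk≈ (trans (sym (toℕ-pow x)) (trans (cong toℕ powx≡powy) (toℕ-pow y))))))

  pow-neg : ∀ x → pow (neg x) ≡ neg (pow x)
  pow-neg zero      = trans pow-zero (cong neg (sym pow-zero))
  pow-neg x@(suc _) = toℕ-injective (≈⇒≡ (toℕ<n (pow (neg x))) (toℕ<n (neg (pow x))) (begin
    toℕ (pow (neg x))    ≡⟨ toℕ-pow (neg x) ⟩
    toℕ (neg x) ^ d % p  ≈⟨ %-≈ (toℕ (neg x) ^ d) ⟩
    toℕ (neg x) ^ d      ≡⟨ cong (_^ d) (toℕ-neg x (λ ())) ⟩
    (p ∸ toℕ x) ^ d      ≈⟨ [p∸x]^odd≈ν*x^odd {e = d} (<⇒≤ (toℕ<n x)) d-odd ⟩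
    ν * toℕ x ^ d        ≈⟨ *-cong (≈-refl {ν}) (%-≈ (toℕ x ^ d)) ⟨
    ν * (toℕ x ^ d % p)  ≡⟨ cong (ν *_) (toℕ-pow x) ⟨
    ν * toℕ (pow x)      ≈⟨ p∸x≈ν*x (<⇒≤ (toℕ<n (pow x))) ⟨
    p ∸ toℕ (pow x)      ≡⟨ toℕ-neg (pow x) (pow-≢0 (λ ())) ⟨
    toℕ (neg (pow x))    ∎))
    where open ≈-Reasoning

  powMap≗shift∘pow : ∀ c x → powMap p d c x ≡ shift c (pow x)
  powMap≗shift∘pow c x = toℕ-injective (begin
    toℕ (powMap p d c x)         ≡⟨ toℕ-fromℕ< _ ⟩
    (toℕ x ^ d + toℕ c) % p      ≡⟨ %-≡ (+-cong (%-≈ (toℕ x ^ d)) (≈-refl {toℕ c})) ⟨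
    (toℕ x ^ d % p + toℕ c) % p  ≡⟨ cong (λ r → (r + toℕ c) % p) (toℕ-pow x) ⟨
    (toℕ (pow x) + toℕ c) % p    ≡⟨ toℕ-shift c (pow x) ⟨
    toℕ (shift c (pow x))        ∎)
    where open ≡-Reasoning

  powMap-injective : ∀ c → Injective _≡_ _≡_ (powMap p d c)
  powMap-injective c {x} {y} eq =
    pow-injective (shift-injective c (trans (sym (powMap≗shift∘pow c x)) (trans eq (powMap≗shift∘pow c y))))

  euler : ∀ x → x ≢ zero → toℕ x ^ m % p ≡ 1 ⊎ toℕ x ^ m % p ≡ ν
  euler x x≢0 = square≈1⇒±1 (m%n<n (toℕ x ^ m) p) (begin
    (toℕ x ^ m % p) * (toℕ x ^ m % p)  ≈⟨ *-cong (%-≈ (toℕ x ^ m)) (%-≈ (toℕ x ^ m)) ⟩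
    toℕ x ^ m * toℕ x ^ m              ≡⟨ ^-distribˡ-+-* (toℕ x) m m ⟨
    toℕ x ^ ν                          ≈⟨ fermat (∤-toℕ x x≢0) ⟩
    1                                  ∎)
    where open ≈-Reasoning

  -- The quadratic character, by Euler's criterion.
  χ : Fin p → Bool
  χ x = does (toℕ x ^ m % p ℕ.≟ 1)

  χ-pow : ∀ x → x ≢ zero → χ (pow x) ≡ χ x
  χ-pow x x≢0 = cong (λ r → does (r ℕ.≟ 1)) (%-≡ (begin
    toℕ (pow x) ^ m      ≡⟨ cong (_^ m) (toℕ-pow x) ⟩
    (toℕ x ^ d % p) ^ m  ≈⟨ ^-cong (%-≈ (toℕ x ^ d)) m ⟩
    (toℕ x ^ d) ^ m      ≡⟨ ^-*-assoc (toℕ x) d m ⟩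
    toℕ x ^ (d * m)      ≡⟨ cong (toℕ x ^_) (*-comm d m) ⟩
    toℕ x ^ (m * d)      ≡⟨ ^-*-assoc (toℕ x) m d ⟨
    (toℕ x ^ m) ^ d      ≈⟨ ^-cong (%-≈ (toℕ x ^ m)) d ⟨
    (toℕ x ^ m % p) ^ d  ≈⟨ ±1^odd (euler x x≢0) ⟩
    toℕ x ^ m % p        ≈⟨ %-≈ (toℕ x ^ m) ⟩
    toℕ x ^ m            ∎))
    where
    open ≈-Reasoning
    ±1^odd : ∀ {t} → t ≡ 1 ⊎ t ≡ ν → t ^ d ≈ t
    ±1^odd (inj₁ refl) = ≡⇒≈ (^-zeroˡ d)
    ±1^odd (inj₂ refl) = ν^odd≈ν {d} d-odd

  ψ : Fin p → Bool
  ψ x = χ x xor upper x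

  module _ (m-odd : parity m ≡ true) where

    χ-neg : ∀ x → x ≢ zero → χ (neg x) ≡ not (χ x)
    χ-neg x x≢0 = [ xᵐ≡1⇒ , xᵐ≡ν⇒ ]′ (euler x x≢0)
      where
      open ≡-Reasoning
      ν≢1 : ν ≢ 1
      ν≢1 ν≡1 = contradiction (trans (sym (parity-double m)) (cong parity ν≡1)) λ ()

      [-x]ᵐ≈ : toℕ (neg x) ^ m ≈ ν * (toℕ x ^ m % p)
      [-x]ᵐ≈ = ≈-trans (≡⇒≈ (cong (_^ m) (toℕ-neg x x≢0)))
               (≈-trans ([p∸x]^odd≈ν*x^odd {e = m} (<⇒≤ (toℕ<n x)) m-odd)
                        (*-cong (≈-refl {ν}) (≈-sym (%-≈ (toℕ x ^ m)))))

      xᵐ≡1⇒ : toℕ x ^ m % p ≡ 1 → χ (neg x) ≡ not (χ x)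
      xᵐ≡1⇒ xᵐ≡1 = begin
        χ (neg x)             ≡⟨ cong (λ r → does (r ℕ.≟ 1))
                                   (≈⇒%≡ (n<1+n ν) (≈-trans [-x]ᵐ≈ (≡⇒≈ (trans (cong (ν *_) xᵐ≡1) (*-identityʳ ν))))) ⟩
        does (ν ℕ.≟ 1)        ≡⟨ dec-false (ν ℕ.≟ 1) ν≢1 ⟩
        false                 ≡⟨ cong (λ r → not (does (r ℕ.≟ 1))) xᵐ≡1 ⟨
        not (χ x)             ∎

      xᵐ≡ν⇒ : toℕ x ^ m % p ≡ ν → χ (neg x) ≡ not (χ x)
      xᵐ≡ν⇒ xᵐ≡ν = begin
        χ (neg x)             ≡⟨ cong (λ r → does (r ℕ.≟ 1))
                                   (≈⇒%≡ 1<p (≈-trans [-x]ᵐ≈ (≈-trans (≡⇒≈ (cong (ν *_) xᵐ≡ν)) ν*ν≈1))) ⟩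
        true                  ≡⟨ cong not (dec-false (ν ℕ.≟ 1) ν≢1) ⟨
        not (does (ν ℕ.≟ 1))  ≡⟨ cong (λ r → not (does (r ℕ.≟ 1))) xᵐ≡ν ⟨
        not (χ x)             ∎

    ψ-neg : ∀ x → ψ (neg x) ≡ ψ x
    ψ-neg zero      = refl
    ψ-neg x@(suc _) = begin
      χ (neg x) xor does (neg (neg x) <? neg x)  ≡⟨ cong₂ _xor_ (χ-neg x (λ ())) lower-neg ⟩
      not (χ x) xor not (upper x)                ≡⟨ xor-annihilates-not (χ x) (upper x) ⟩
      χ x xor upper x                            ∎
      where
      open ≡-Reasoning
      lower-neg : does (neg (neg x) <? neg x) ≡ not (upper x)
      lower-neg = trans (cong (λ y → does (y <? neg x)) (neg-involutive x)) (lower≡not-upper {m} x (λ ()))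

    lower∧upper∘pow : ∀ i → lower i ∧ upper (pow i) ≡ (lower i ∧ ψ (pow i)) xor (lower i ∧ ψ i)
    lower∧upper∘pow zero      = refl
    lower∧upper∘pow i@(suc _) = rearrange (lower≡not-upper {m} i (λ ())) (χ-pow i (λ ()))
      where
      rearrange : ∀ {l u U c c′} → l ≡ not u → c′ ≡ c → l ∧ U ≡ (l ∧ (c′ xor U)) xor (l ∧ (c xor u))
      rearrange {u = true}                      refl refl = refl
      rearrange {u = false} {false} {c = false} refl refl = refl
      rearrange {u = false} {false} {c = true}  refl refl = refl
      rearrange {u = false} {true}  {c = false} refl refl = refl
      rearrange {u = false} {true}  {c = true}  refl refl = refl

    ⨁-lower∧ψ∘pow : ⨁[ i < p ] (lower i ∧ ψ (pow i)) ≡ ⨁[ i < p ] (lower i ∧ ψ i)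
    ⨁-lower∧ψ∘pow = ⨁-lowerHalf (ψ ∘ pow) ψ ψ∘pow-neg ψ-neg fixed-points-agree (count-reindex pow-injective ψ)
      where
      open Involution (neg {ν}) neg-involutive
      ψ∘pow-neg : ∀ i → ψ (pow (neg i)) ≡ ψ (pow i)
      ψ∘pow-neg i = trans (cong ψ (pow-neg i)) (ψ-neg (pow i))
      fixed-points-agree : ∀ i → i ≡ neg i → ψ (pow i) ≡ ψ i
      fixed-points-agree i i≡-i =
        subst (λ j → ψ (pow j) ≡ ψ j) (sym (neg-fixed⇒zero {m} i (sym i≡-i))) (cong ψ pow-zero)

    inversionParity-pow : inversionParity pow ≡ false
    inversionParity-pow = begin
      inversionParity pow
        ≡⟨ inversionParity-neg pow-injective pow-zero pow-neg ⟩
      ⨁[ i < p ] (lower i ∧ upper (pow i))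
        ≡⟨ 𝔽₂.sum-cong-≗ {p} lower∧upper∘pow ⟩
      ⨁[ i < p ] ((lower i ∧ ψ (pow i)) xor (lower i ∧ ψ i))
        ≡⟨ 𝔽₂.∑-distrib-+ {p} (λ i → lower i ∧ ψ (pow i)) (λ i → lower i ∧ ψ i) ⟩
      (⨁[ i < p ] (lower i ∧ ψ (pow i))) xor (⨁[ i < p ] (lower i ∧ ψ i))
        ≡⟨ cong (_xor (⨁[ i < p ] (lower i ∧ ψ i))) ⨁-lower∧ψ∘pow ⟩
      (⨁[ i < p ] (lower i ∧ ψ i)) xor (⨁[ i < p ] (lower i ∧ ψ i))
        ≡⟨ xor-same (⨁[ i < p ] (lower i ∧ ψ i)) ⟩
      false ∎
      where open ≡-Reasoning

    inversionParity-powMap : ∀ c → inversionParity (powMap p d c) ≡ false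
    inversionParity-powMap c = begin
      inversionParity (powMap p d c)   ≡⟨ inversionParity-cong (powMap≗shift∘pow c) ⟩
      inversionParity (shift c ∘ pow)  ≡⟨ inversionParity-shift (cong not (parity-double m)) c pow ⟩
      inversionParity pow              ≡⟨ inversionParity-pow ⟩
      false                            ∎
      where open ≡-Reasoning

3mod4⇒odd-half : ∀ p → p % 4 ≡ 3 → ∃ λ m → parity m ≡ true × p ≡ suc (m + m)
3mod4⇒odd-half p p%4≡3 = suc (k + k) , cong not (parity-double k) , (begin
  p                                ≡⟨ m≡m%n+[m/n]*n p 4 ⟩
  p % 4 + k * 4                    ≡⟨ cong (_+ k * 4) p%4≡3 ⟩
  3 + k * 4                        ≡⟨ regroup k ⟩
  suc (suc (k + k) + suc (k + k))  ∎)
  where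
  open ≡-Reasoning
  k : ℕ
  k = p / 4
  regroup : ∀ k → 3 + k * 4 ≡ suc (suc (k + k) + suc (k + k))
  regroup = solve-∀

lemma3p4 : (p : ℕ) → (pp : Prime p) → p % 4 ≡ 3 →
    (d : ℕ) → 1 ≤ d → d < p ∸ 1 → gcd d (p ∸ 1) ≡ 1 →
    (c : Fin p) →
    Injective _≡_ _≡_ (powMapPrime p pp d c) × IsEvenPerm (powMapPrime p pp d c)
lemma3p4 p pp p%4≡3 d _ _ coprime c with 3mod4⇒odd-half p p%4≡3
... | m , m-odd , refl =
  powMap-injective c ,
  parity≡false⇒Even _ (trans (parity-inversions (powMapPrime _ pp d c)) (inversionParity-powMap m-odd c))
  where open PowerMap m pp d coprime
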